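{- The following (in)equations are derivable from A1–A4 and WF1–WF3 (for all $a\in A$, all finite index sets $I$, and all terms $t_i,y_i$ where indicated): D1 $\tau(x+y)+x\approx\tau(x+y)$; D2 $\tau(\tau x+y)\approx\tau x+y$; D3 $ax+\tau(ay+z)\approx\tau(ax+ay+z)$; D4 $\tau x\preccurlyeq\tau x+y$; D5 $\sum_{i\in I}ax_i\approx a(\sum_{i\in I}\tau x_i)$ for finite nonempty $I$; D6 $\tau x+y\approx\tau x+\tau(x+y)$; D7 $\tau x+\tau y\approx\tau x+\tau(x+y)+\tau y$; D8 $\tau x+\tau(x+y+z)\approx\tau x+\tau(x+y)+\tau(x+y+z)$; D9 $\sum_{i\in I}\tau(at_i+y_i)\approx\sum_{i\in I}\tau(at+y_i)$ for finite $I$, where $t=\sum_{i\in I}\tau t_i$.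
   Context: $\mathrm{BCCS}(A)$ terms over a nonempty action set $A$, silent action $\tau\notin A$, and a countably infinite set of variables: $t::=\mathbf{0}\mid\alpha t\mid t+t\mid x$ with $\alpha\in A\cup\{\tau\}$; $\sum_{i\in I}t_i$ is $t_1+\cdots+t_n$, empty sum $\mathbf{0}$. Derivations of inequations use reflexivity, transitivity, substitution of terms for variables, and closure under the BCCS operators; an equation $t\approx u$ abbreviates $t\preccurlyeq u$ and $u\preccurlyeq t$. Axioms: A1 $x+y\approx y+x$; A2 $(x+y)+z\approx x+(y+z)$; A3 $x+x\approx x$; A4 $x+\mathbf{0}\approx x$; WF1 $ax+ay\approx a(\tau x+\tau y)$ ($a\in A$); WF2 $\tau(x+y)\preccurlyeq\tau x+y$; WF3 $x\preccurlyeq\tau x+y$. -}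

module Defs where

open import Data.Nat using (ℕ)
open import Data.List using (List; []; _∷_; map)
open import Data.List.NonEmpty using (List⁺; _∷_; toList)
open import Data.Product using (_×_; _,_; proj₁; proj₂)

data Act (A : Set) : Set where
  τ   : Act A
  vis : A → Act A

infixl 6 _⊕_
data Term (A : Set) : Set where
  𝟎    : Term A
  pre  : Act A → Term A → Term A
  _⊕_  : Term A → Term A → Term A
  var  : ℕ → Term A

module _ {A : Set} where

  _[_] : Term A → (ℕ → Term A) → Term A
  𝟎 [ σ ] = 𝟎
  pre α t [ σ ] = pre α (t [ σ ])
  (t ⊕ u) [ σ ] = (t [ σ ]) ⊕ (u [ σ ])
  var n [ σ ] = σ n

  Σ : List (Term A) → Term A
  Σ [] = 𝟎
  Σ (t ∷ []) = t
  Σ (t ∷ ts@(_ ∷ _)) = t ⊕ Σ ts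

  τ· : Term A → Term A
  τ· = pre τ

  x₀ y₀ z₀ : Term A
  x₀ = var 0
  y₀ = var 1
  z₀ = var 2

  -- Axiom inequations (an equation contributes both directions)
  data Ax : Term A → Term A → Set where
    A1  : Ax (x₀ ⊕ y₀) (y₀ ⊕ x₀)
    A2l : Ax ((x₀ ⊕ y₀) ⊕ z₀) (x₀ ⊕ (y₀ ⊕ z₀))
    A2r : Ax (x₀ ⊕ (y₀ ⊕ z₀)) ((x₀ ⊕ y₀) ⊕ z₀)
    A3l : Ax (x₀ ⊕ x₀) x₀
    A3r : Ax x₀ (x₀ ⊕ x₀)
    A4l : Ax (x₀ ⊕ 𝟎) x₀
    A4r : Ax x₀ (x₀ ⊕ 𝟎)
    WF1l : (a : A) → Ax (pre (vis a) x₀ ⊕ pre (vis a) y₀) (pre (vis a) (τ· x₀ ⊕ τ· y₀))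
    WF1r : (a : A) → Ax (pre (vis a) (τ· x₀ ⊕ τ· y₀)) (pre (vis a) x₀ ⊕ pre (vis a) y₀)
    WF2 : Ax (τ· (x₀ ⊕ y₀)) (τ· x₀ ⊕ y₀)
    WF3 : Ax x₀ (τ· x₀ ⊕ y₀)

  infix 4 _≼_ _≈_
  data _≼_ : Term A → Term A → Set where
    ax     : ∀ {t u} → Ax t u → t ≼ u
    refl   : ∀ {t} → t ≼ t
    trans  : ∀ {t u v} → t ≼ u → u ≼ v → t ≼ v
    subst  : ∀ {t u} (σ : ℕ → Term A) → t ≼ u → (t [ σ ]) ≼ (u [ σ ])
    pre-cong : ∀ {t u} (α : Act A) → t ≼ u → pre α t ≼ pre α u
    ⊕-cong : ∀ {t t' u u'} → t ≼ t' → u ≼ u' → t ⊕ u ≼ t' ⊕ u'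

  _≈_ : Term A → Term A → Set
  t ≈ u = (t ≼ u) × (u ≼ t)

-- The τ-laws rest on two
-- consequences of WF2 and WF3, x ≼ τx and τx ≼ τx + x, which together let τp absorb any
-- summand of p (D1). For a visible action ax ≈ a(τx) (WF1 with y = x), so a nonempty sum of
-- a-prefixed terms collapses to a single one (D5), and ay ≼ ay + ax, which yields D3. D9 follows
-- by adding to Σ τ(a tᵢ + yᵢ) the summands a tᵢ it absorbs, replacing their sum by a t, and
-- pushing a t inside each τ with D3.
module Submission where

open import Algebra.Bundles using (IdempotentCommutativeMonoid)
import Algebra.Solver.IdempotentCommutativeMonoid as ICM-Solver
open import Data.List using (List; []; _∷_; map; foldr)
open import Data.List.Membership.Propositional using (_∈_)
open import Data.List.Membership.Propositional.Properties using (∈-map⁺)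
open import Data.List.NonEmpty using (List⁺; toList; _∷_)
open import Data.List.Relation.Unary.Any using (here; there)
open import Data.Nat using (ℕ; zero; suc)
open import Data.Product using (_×_; _,_; proj₁; proj₂)
open import Relation.Binary.Bundles using (Preorder)
open import Relation.Binary.Structures using (IsEquivalence)
import Relation.Binary.PropositionalEquality as ≡
import Relation.Binary.Reasoning.Preorder as PreorderReasoning

open import Defs

module _ {A : Set} where

  σ₃ : Term A → Term A → Term A → ℕ → Term A
  σ₃ x y z zero = x
  σ₃ x y z (suc zero) = y
  σ₃ x y z (suc (suc _)) = z

  ≈-isEquivalence : IsEquivalence (_≈_ {A})
  ≈-isEquivalence = record
    { refl  = refl , refl
    ; sym   = λ (p , q) → q , p
    ; trans = λ (p , q) (p′ , q′) → trans p p′ , trans q′ q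
    }

  open IsEquivalence ≈-isEquivalence
    using () renaming (refl to ≈-refl; sym to ≈-sym; trans to ≈-trans)

  ≼-preorder : Preorder _ _ _
  ≼-preorder = record
    { Carrier = Term A
    ; _≈_ = _≈_
    ; _≲_ = _≼_
    ; isPreorder = record { isEquivalence = ≈-isEquivalence ; reflexive = proj₁ ; trans = trans }
    }

  open PreorderReasoning ≼-preorder

  ⊕-≈-cong : ∀ {t t′ u u′ : Term A} → t ≈ t′ → u ≈ u′ → t ⊕ u ≈ t′ ⊕ u′
  ⊕-≈-cong (p , q) (p′ , q′) = ⊕-cong p p′ , ⊕-cong q q′

  pre-≈-cong : ∀ {t u : Term A} (α : Act A) → t ≈ u → pre α t ≈ pre α u
  pre-≈-cong α (p , q) = pre-cong α p , pre-cong α q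

  ⊕-comm : ∀ (x y : Term A) → x ⊕ y ≈ y ⊕ x
  ⊕-comm x y = subst (σ₃ x y 𝟎) (ax A1) , subst (σ₃ y x 𝟎) (ax A1)

  ⊕-assoc : ∀ (x y z : Term A) → x ⊕ y ⊕ z ≈ x ⊕ (y ⊕ z)
  ⊕-assoc x y z = subst (σ₃ x y z) (ax A2l) , subst (σ₃ x y z) (ax A2r)

  ⊕-idem : ∀ (x : Term A) → x ⊕ x ≈ x
  ⊕-idem x = subst (σ₃ x 𝟎 𝟎) (ax A3l) , subst (σ₃ x 𝟎 𝟎) (ax A3r)

  ⊕-identityʳ : ∀ (x : Term A) → x ⊕ 𝟎 ≈ x
  ⊕-identityʳ x = subst (σ₃ x 𝟎 𝟎) (ax A4l) , subst (σ₃ x 𝟎 𝟎) (ax A4r)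

  ⊕-idempotentCommutativeMonoid : IdempotentCommutativeMonoid _ _
  ⊕-idempotentCommutativeMonoid = record
    { Carrier = Term A
    ; _≈_ = _≈_
    ; _∙_ = _⊕_
    ; ε = 𝟎
    ; isIdempotentCommutativeMonoid = record
      { isCommutativeMonoid = record
        { isMonoid = record
          { isSemigroup = record
            { isMagma = record { isEquivalence = ≈-isEquivalence ; ∙-cong = ⊕-≈-cong }
            ; assoc = ⊕-assoc
            }
          ; identity = (λ x → ≈-trans (⊕-comm 𝟎 x) (⊕-identityʳ x)) , ⊕-identityʳ
          }
        ; comm = ⊕-comm
        }
      ; idem = ⊕-idem
      }
    }

  open ICM-Solver ⊕-idempotentCommutativeMonoid using (solve; _⊜_) renaming (_⊕_ to _⊞_)

  wf1 : ∀ (a : A) (x y : Term A) → pre (vis a) x ⊕ pre (vis a) y ≈ pre (vis a) (τ· x ⊕ τ· y)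
  wf1 a x y = subst (σ₃ x y 𝟎) (ax (WF1l a)) , subst (σ₃ x y 𝟎) (ax (WF1r a))

  wf2 : ∀ (x y : Term A) → τ· (x ⊕ y) ≼ τ· x ⊕ y
  wf2 x y = subst (σ₃ x y 𝟎) (ax WF2)

  wf3 : ∀ (x y : Term A) → x ≼ τ· x ⊕ y
  wf3 x y = subst (σ₃ x y 𝟎) (ax WF3)

  ≼-τ : ∀ (x : Term A) → x ≼ τ· x
  ≼-τ x = begin
    x        ≲⟨ wf3 x 𝟎 ⟩
    τ· x ⊕ 𝟎 ≈⟨ ⊕-identityʳ _ ⟩
    τ· x     ∎

  τ≼τ⊕self : ∀ (x : Term A) → τ· x ≼ τ· x ⊕ x
  τ≼τ⊕self x = begin
    τ· x       ≈⟨ pre-≈-cong τ (⊕-idem x) ⟨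
    τ· (x ⊕ x) ≲⟨ wf2 x x ⟩
    τ· x ⊕ x   ∎

  τ-absorb-summand : ∀ {p q : Term A} → p ⊕ q ≈ p → τ· p ⊕ q ≈ τ· p
  τ-absorb-summand {p} {q} p⊕q≈p =
    (begin
      τ· p ⊕ q       ≲⟨ ⊕-cong (τ≼τ⊕self p) refl ⟩
      τ· p ⊕ p ⊕ q   ≈⟨ ⊕-assoc _ _ _ ⟩
      τ· p ⊕ (p ⊕ q) ≈⟨ ⊕-≈-cong ≈-refl p⊕q≈p ⟩
      τ· p ⊕ p       ≲⟨ ⊕-cong refl (≼-τ p) ⟩
      τ· p ⊕ τ· p    ≈⟨ ⊕-idem _ ⟩
      τ· p           ∎)
    , (begin
      τ· p       ≈⟨ pre-≈-cong τ p⊕q≈p ⟨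
      τ· (p ⊕ q) ≲⟨ wf2 p q ⟩
      τ· p ⊕ q   ∎)

  τ-absorbˡ : ∀ (x y : Term A) → τ· (x ⊕ y) ⊕ x ≈ τ· (x ⊕ y)
  τ-absorbˡ x y = τ-absorb-summand (solve 2 (λ x y → (x ⊞ y) ⊞ x ⊜ x ⊞ y) ≈-refl x y)

  τ-stable : ∀ (x y : Term A) → τ· (τ· x ⊕ y) ≈ τ· x ⊕ y
  τ-stable x y =
    (begin
      τ· (τ· x ⊕ y)        ≲⟨ pre-cong τ (⊕-cong (τ≼τ⊕self x) refl) ⟩
      τ· (τ· x ⊕ x ⊕ y)    ≈⟨ pre-≈-cong τ (solve 3 (λ u v w → (u ⊞ v) ⊞ w ⊜ v ⊞ (u ⊞ w)) ≈-refl (τ· x) x y) ⟩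
      τ· (x ⊕ (τ· x ⊕ y))  ≲⟨ wf2 _ _ ⟩
      τ· x ⊕ (τ· x ⊕ y)    ≈⟨ solve 2 (λ u v → u ⊞ (u ⊞ v) ⊜ u ⊞ v) ≈-refl (τ· x) y ⟩
      τ· x ⊕ y             ∎)
    , ≼-τ _

  τ-τ : ∀ (x : Term A) → τ· (τ· x) ≈ τ· x
  τ-τ x = begin-equality
    τ· (τ· x)       ≈⟨ pre-≈-cong τ (⊕-identityʳ _) ⟨
    τ· (τ· x ⊕ 𝟎)   ≈⟨ τ-stable x 𝟎 ⟩
    τ· x ⊕ 𝟎        ≈⟨ ⊕-identityʳ _ ⟩
    τ· x            ∎

  τ≼τ⊕ : ∀ (x y : Term A) → τ· x ≼ τ· x ⊕ y
  τ≼τ⊕ x y = begin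
    τ· x          ≲⟨ pre-cong τ (wf3 x y) ⟩
    τ· (τ· x ⊕ y) ≈⟨ τ-stable x y ⟩
    τ· x ⊕ y      ∎

  vis-τ : ∀ (a : A) (x : Term A) → pre (vis a) x ≈ pre (vis a) (τ· x)
  vis-τ a x = begin-equality
    pre (vis a) x                  ≈⟨ ⊕-idem _ ⟨
    pre (vis a) x ⊕ pre (vis a) x  ≈⟨ wf1 a x x ⟩
    pre (vis a) (τ· x ⊕ τ· x)      ≈⟨ pre-≈-cong (vis a) (⊕-idem _) ⟩
    pre (vis a) (τ· x)             ∎

  vis≼vis⊕vis : ∀ (a : A) (x y : Term A) → pre (vis a) x ≼ pre (vis a) x ⊕ pre (vis a) y
  vis≼vis⊕vis a x y = begin
    pre (vis a) x                 ≈⟨ vis-τ a x ⟩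
    pre (vis a) (τ· x)            ≲⟨ pre-cong (vis a) (τ≼τ⊕ x (τ· y)) ⟩
    pre (vis a) (τ· x ⊕ τ· y)     ≈⟨ wf1 a x y ⟨
    pre (vis a) x ⊕ pre (vis a) y ∎

  vis-into-τ : ∀ (a : A) (x y z : Term A) →
    pre (vis a) x ⊕ τ· (pre (vis a) y ⊕ z) ≈ τ· (pre (vis a) x ⊕ pre (vis a) y ⊕ z)
  vis-into-τ a x y z =
    (begin
      a·x ⊕ τ· (a·y ⊕ z)        ≲⟨ ⊕-cong refl (pre-cong τ (⊕-cong (vis≼vis⊕vis a y x) refl)) ⟩
      a·x ⊕ τ· (a·y ⊕ a·x ⊕ z)  ≈⟨ ⊕-≈-cong ≈-refl (pre-≈-cong τ (solve 3 (λ u v w → (v ⊞ u) ⊞ w ⊜ (u ⊞ v) ⊞ w) ≈-refl a·x a·y z)) ⟩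
      a·x ⊕ τ· (a·x ⊕ a·y ⊕ z)  ≈⟨ ⊕-comm _ _ ⟩
      τ· (a·x ⊕ a·y ⊕ z) ⊕ a·x  ≈⟨ τ-absorb-summand (solve 3 (λ u v w → ((u ⊞ v) ⊞ w) ⊞ u ⊜ (u ⊞ v) ⊞ w) ≈-refl a·x a·y z) ⟩
      τ· (a·x ⊕ a·y ⊕ z)        ∎)
    , (begin
      τ· (a·x ⊕ a·y ⊕ z)        ≈⟨ pre-≈-cong τ (solve 3 (λ u v w → (u ⊞ v) ⊞ w ⊜ (v ⊞ w) ⊞ u) ≈-refl a·x a·y z) ⟩
      τ· (a·y ⊕ z ⊕ a·x)        ≲⟨ wf2 _ _ ⟩
      τ· (a·y ⊕ z) ⊕ a·x        ≈⟨ ⊕-comm _ _ ⟩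
      a·x ⊕ τ· (a·y ⊕ z)        ∎)
    where
    a·x = pre (vis a) x
    a·y = pre (vis a) y

  τ⊕-saturate : ∀ (x y : Term A) → τ· x ⊕ y ≈ τ· x ⊕ τ· (x ⊕ y)
  τ⊕-saturate x y =
    (begin
      τ· x ⊕ y           ≲⟨ ⊕-cong (τ≼τ⊕self x) refl ⟩
      τ· x ⊕ x ⊕ y       ≈⟨ ⊕-assoc _ _ _ ⟩
      τ· x ⊕ (x ⊕ y)     ≲⟨ ⊕-cong refl (≼-τ _) ⟩
      τ· x ⊕ τ· (x ⊕ y)  ∎)
    , (begin
      τ· x ⊕ τ· (x ⊕ y)  ≲⟨ ⊕-cong refl (wf2 x y) ⟩
      τ· x ⊕ (τ· x ⊕ y)  ≈⟨ solve 2 (λ u v → u ⊞ (u ⊞ v) ⊜ u ⊞ v) ≈-refl (τ· x) y ⟩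
      τ· x ⊕ y           ∎)

  τ-insert : ∀ {x u v : Term A} → u ≼ v ⊕ τ· x → τ· x ⊕ τ· v ≈ τ· x ⊕ τ· u ⊕ τ· v
  τ-insert {x} {u} {v} u≼v⊕τx =
    ⊕-cong (τ≼τ⊕ x _) refl
    , (begin
      τ· x ⊕ τ· u ⊕ τ· v           ≲⟨ ⊕-cong (⊕-cong refl (trans (pre-cong τ u≼v⊕τx) (wf2 v _))) refl ⟩
      τ· x ⊕ (τ· v ⊕ τ· x) ⊕ τ· v  ≈⟨ solve 2 (λ p q → (p ⊞ (q ⊞ p)) ⊞ q ⊜ p ⊞ q) ≈-refl (τ· x) (τ· v) ⟩
      τ· x ⊕ τ· v                  ∎)

  τ⊕τ-join : ∀ (x y : Term A) → τ· x ⊕ τ· y ≈ τ· x ⊕ τ· (x ⊕ y) ⊕ τ· y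
  τ⊕τ-join x y = τ-insert (begin
    x ⊕ y      ≈⟨ ⊕-comm x y ⟩
    y ⊕ x      ≲⟨ ⊕-cong refl (≼-τ x) ⟩
    y ⊕ τ· x   ∎)

  τ⊕τ-interpolate : ∀ (x y z : Term A) →
    τ· x ⊕ τ· (x ⊕ y ⊕ z) ≈ τ· x ⊕ τ· (x ⊕ y) ⊕ τ· (x ⊕ y ⊕ z)
  τ⊕τ-interpolate x y z = τ-insert (begin
    x ⊕ y               ≈⟨ ⊕-≈-cong (⊕-idem x) ≈-refl ⟨
    x ⊕ x ⊕ y           ≲⟨ ⊕-cong (⊕-cong refl (wf3 x z)) refl ⟩
    x ⊕ (τ· x ⊕ z) ⊕ y  ≈⟨ solve 4 (λ x u z y → (x ⊞ (u ⊞ z)) ⊞ y ⊜ ((x ⊞ y) ⊞ z) ⊞ u) ≈-refl x (τ· x) z y ⟩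
    x ⊕ y ⊕ z ⊕ τ· x    ∎)

  ⨁ : List (Term A) → Term A
  ⨁ = foldr _⊕_ 𝟎

  Σ≈⨁ : ∀ (ts : List (Term A)) → Σ ts ≈ ⨁ ts
  Σ≈⨁ [] = ≈-refl
  Σ≈⨁ (t ∷ []) = ≈-sym (⊕-identityʳ t)
  Σ≈⨁ (t ∷ ts@(_ ∷ _)) = ⊕-≈-cong ≈-refl (Σ≈⨁ ts)

  ⨁-absorbs-∈ : ∀ {t : Term A} {ts : List (Term A)} → t ∈ ts → ⨁ ts ⊕ t ≈ ⨁ ts
  ⨁-absorbs-∈ {t} {_ ∷ ts} (here ≡.refl) = solve 2 (λ t r → (t ⊞ r) ⊞ t ⊜ t ⊞ r) ≈-refl t (⨁ ts)
  ⨁-absorbs-∈ {t} {u ∷ ts} (there t∈ts) = ≈-trans (⊕-assoc u (⨁ ts) t) (⊕-≈-cong ≈-refl (⨁-absorbs-∈ t∈ts))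

  module _ {X : Set} where

    ⨁-map-cong : ∀ {f g : X → Term A} (l : List X) →
      (∀ {p} → p ∈ l → f p ≈ g p) → ⨁ (map f l) ≈ ⨁ (map g l)
    ⨁-map-cong [] _ = ≈-refl
    ⨁-map-cong (p ∷ l) f≈g = ⊕-≈-cong (f≈g (here ≡.refl)) (⨁-map-cong l (λ p∈l → f≈g (there p∈l)))

    ⨁-map-⊕ : ∀ (f g : X → Term A) (l : List X) →
      ⨁ (map (λ p → f p ⊕ g p) l) ≈ ⨁ (map f l) ⊕ ⨁ (map g l)
    ⨁-map-⊕ f g [] = ≈-sym (⊕-idem 𝟎)
    ⨁-map-⊕ f g (p ∷ l) = ≈-trans (⊕-≈-cong ≈-refl (⨁-map-⊕ f g l))
      (solve 4 (λ u v F G → (u ⊞ v) ⊞ (F ⊞ G) ⊜ (u ⊞ F) ⊞ (v ⊞ G)) ≈-refl (f p) (g p) (⨁ (map f l)) (⨁ (map g l)))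

    ⨁-map-const : ∀ (c : Term A) (p : X) (l : List X) → ⨁ (map (λ _ → c) (p ∷ l)) ≈ c
    ⨁-map-const c p [] = ⊕-identityʳ c
    ⨁-map-const c p (q ∷ l) = ≈-trans (⊕-≈-cong ≈-refl (⨁-map-const c q l)) (⊕-idem c)

    Σ-τ-stable : ∀ (f : X → Term A) (p : X) (l : List X) →
      τ· (Σ (map (λ q → τ· (f q)) (p ∷ l))) ≈ Σ (map (λ q → τ· (f q)) (p ∷ l))
    Σ-τ-stable f p [] = τ-τ (f p)
    Σ-τ-stable f p (_ ∷ _) = τ-stable (f p) _

    Σ-vis : ∀ (a : A) (f : X → Term A) (p : X) (l : List X) →
      Σ (map (λ q → pre (vis a) (f q)) (p ∷ l)) ≈ pre (vis a) (Σ (map (λ q → τ· (f q)) (p ∷ l)))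
    Σ-vis a f p [] = vis-τ a (f p)
    Σ-vis a f p (q ∷ l) = begin-equality
      pre (vis a) (f p) ⊕ Σ (map a·f (q ∷ l))               ≈⟨ ⊕-≈-cong ≈-refl (Σ-vis a f q l) ⟩
      pre (vis a) (f p) ⊕ pre (vis a) (Σ (map τf (q ∷ l)))  ≈⟨ wf1 a _ _ ⟩
      pre (vis a) (τ· (f p) ⊕ τ· (Σ (map τf (q ∷ l))))     ≈⟨ pre-≈-cong (vis a) (⊕-≈-cong ≈-refl (Σ-τ-stable f q l)) ⟩
      pre (vis a) (τ· (f p) ⊕ Σ (map τf (q ∷ l)))          ∎
      where
      a·f τf : X → Term A
      a·f q = pre (vis a) (f q)
      τf q = τ· (f q)

    Σ-τ-vis-uniform : ∀ (a : A) (t y : X → Term A) (l : List X) →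
      Σ (map (λ p → τ· (pre (vis a) (t p) ⊕ y p)) l)
        ≈ Σ (map (λ p → τ· (pre (vis a) (Σ (map (λ q → τ· (t q)) l)) ⊕ y p)) l)
    Σ-τ-vis-uniform a t y [] = ≈-refl
    Σ-τ-vis-uniform a t y l@(p ∷ ps) = begin-equality
      Σ (map L l)                           ≈⟨ Σ≈⨁ (map L l) ⟩
      ⨁ (map L l)                           ≈⟨ ⨁-map-cong l (λ {p} _ → τ-absorbˡ (a·t p) (y p)) ⟨
      ⨁ (map (λ p → L p ⊕ a·t p) l)         ≈⟨ ⨁-map-⊕ L a·t l ⟩
      ⨁ (map L l) ⊕ ⨁ (map a·t l)           ≈⟨ ⊕-≈-cong ≈-refl ⨁a·t≈a·T ⟩
      ⨁ (map L l) ⊕ a·T                     ≈⟨ ⊕-comm _ _ ⟩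
      a·T ⊕ ⨁ (map L l)                     ≈⟨ ⊕-≈-cong (⨁-map-const a·T p ps) ≈-refl ⟨
      ⨁ (map (λ _ → a·T) l) ⊕ ⨁ (map L l)   ≈⟨ ⨁-map-⊕ (λ _ → a·T) L l ⟨
      ⨁ (map (λ p → a·T ⊕ L p) l)           ≈⟨ ⨁-map-cong l merge ⟩
      ⨁ (map R l)                           ≈⟨ Σ≈⨁ (map R l) ⟨
      Σ (map R l)                           ∎
      where
      a·t L R : X → Term A
      a·t q = pre (vis a) (t q)
      L q = τ· (a·t q ⊕ y q)
      a·T = pre (vis a) (Σ (map (λ q → τ· (t q)) l))
      R q = τ· (a·T ⊕ y q)
      ⨁a·t≈a·T : ⨁ (map a·t l) ≈ a·T
      ⨁a·t≈a·T = ≈-trans (≈-sym (Σ≈⨁ (map a·t l))) (Σ-vis a t p ps)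
      merge : ∀ {q} → q ∈ l → a·T ⊕ L q ≈ R q
      merge {q} q∈l = begin-equality
        a·T ⊕ τ· (a·t q ⊕ y q)   ≈⟨ vis-into-τ a _ (t q) (y q) ⟩
        τ· (a·T ⊕ a·t q ⊕ y q)   ≈⟨ pre-≈-cong τ (⊕-≈-cong a·T-absorbs ≈-refl) ⟩
        τ· (a·T ⊕ y q)           ∎
        where
        a·T-absorbs : a·T ⊕ a·t q ≈ a·T
        a·T-absorbs = begin-equality
          a·T ⊕ a·t q             ≈⟨ ⊕-≈-cong ⨁a·t≈a·T ≈-refl ⟨
          ⨁ (map a·t l) ⊕ a·t q   ≈⟨ ⨁-absorbs-∈ (∈-map⁺ a·t q∈l) ⟩
          ⨁ (map a·t l)           ≈⟨ ⨁a·t≈a·T ⟩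
          a·T                     ∎

lemma1 : {A : Set} →
    (∀ (x y : Term A) → τ· (x ⊕ y) ⊕ x ≈ τ· (x ⊕ y))
    × (∀ (x y : Term A) → τ· (τ· x ⊕ y) ≈ τ· x ⊕ y)
    × (∀ (a : A) (x y z : Term A) →
         pre (vis a) x ⊕ τ· (pre (vis a) y ⊕ z) ≈ τ· (pre (vis a) x ⊕ pre (vis a) y ⊕ z))
    × (∀ (x y : Term A) → τ· x ≼ τ· x ⊕ y)
    × (∀ (a : A) (xs : List⁺ (Term A)) →
         Σ (map (pre (vis a)) (toList xs)) ≈ pre (vis a) (Σ (map τ· (toList xs))))
    × (∀ (x y : Term A) → τ· x ⊕ y ≈ τ· x ⊕ τ· (x ⊕ y))
    × (∀ (x y : Term A) → τ· x ⊕ τ· y ≈ τ· x ⊕ τ· (x ⊕ y) ⊕ τ· y)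
    × (∀ (x y z : Term A) →
         τ· x ⊕ τ· (x ⊕ y ⊕ z) ≈ τ· x ⊕ τ· (x ⊕ y) ⊕ τ· (x ⊕ y ⊕ z))
    × (∀ (a : A) (tys : List (Term A × Term A)) →
         Σ (map (λ p → τ· (pre (vis a) (proj₁ p) ⊕ proj₂ p)) tys)
           ≈ Σ (map (λ p → τ· (pre (vis a) (Σ (map (λ q → τ· (proj₁ q)) tys)) ⊕ proj₂ p)) tys))
lemma1 =
  τ-absorbˡ
  , τ-stable
  , vis-into-τ
  , τ≼τ⊕
  , (λ { a (x ∷ xs) → Σ-vis a (λ t → t) x xs })
  , τ⊕-saturate
  , τ⊕τ-join
  , τ⊕τ-interpolate
  , (λ a → Σ-τ-vis-uniform a proj₁ proj₂)
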